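{- Let $(G,K,\mathcal{T},tw)$ be an instance of Eulerian Steiner Subgraph with $\mathcal{T}$ the nearly-nice tree decomposition described in the context, and let $t$ be a node of $\mathcal{T}$. Let $X\subseteq X_t$, $O\subseteq X$, and let $\mathcal{A}$ be a collection of partitions of $X$, each valid for $(t,X,O)$. Let $\mathcal{B}$ be a representative subset of $\mathcal{A}$ and let $H$ be any residual subgraph of $G$ with respect to $t$ with $V(H)\cap X_t=X$. If some $P\in\mathcal{A}$ is such that $((t,X,O),P)$ completes $H$, then some $Q\in\mathcal{B}$ is such that $((t,X,O),Q)$ completes $H$.
   Context: A graph is Eulerian if it is connected and all degrees are even. An instance of Eulerian Steiner Subgraph consists of a graph $G$, terminals $K\subseteq V(G)$ (assumed non-empty) and a tree decomposition of width $tw$; an Eulerian Steiner subgraph for $K$ is an Eulerian subgraph of $G$ containing all of $K$. A nice tree decomposition is a rooted tree decomposition $(T,\{X_t\})$ whose root and leaf bags are empty and each non-leaf node is an introduce vertex node (one child $t'$, $X_t=X_{t'}\cup\{v\}$), an introduce edge node (one child with the same bag, labelled by an edge $uv$ with $u,v\in X_t$; each edge of $G$ is introduced at exactly one such node), a forget node (one child $t'$, $X_t=X_{t'}\setminus\{v\}$), or a join node (two children with bags equal to $X_t$). The nearly-nice $\mathcal{T}$ is obtained from a nice one by adding a fixed terminal $v^\star\in K$ to every bag. For node $t$: $V_t$ = union of bags in the subtree at $t$, $E_t$ = edges introduced in that subtree, $G_t=(V_t,E_t)$. $H\subseteq G$ is residual w.r.t. $t$ if $V(H)\cap(V_t\setminus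 X_t)=\emptyset$ and $E(H)\cap E_t=\emptyset$. The partition of $X$ defined by a graph $F$ has blocks $X\cap V(C)$ over components $C$ of $F$ meeting $X$. A partition $P=\{X^1,\dots,X^p\}$ of $X\subseteq X_t$ is valid for $(t,X,O)$, $O\subseteq X$, if some subgraph $G'_t$ of $G_t$ (a witness) has $X_t\cap V(G'_t)=X$, exactly $p$ components $C_i$ with $X^i\subseteq V(C_i)$, contains all terminals of $K\cap V_t$, and has odd-degree vertex set exactly $O$. $((t,X,O),P)$ completes a residual $H$ with $V(H)\cap X_t=X$ if some witness $G'_t$ makes $G'_t\cup H$ an Eulerian Steiner subgraph for $K$. The join $P\sqcup R$ of partitions is the finest partition coarser than both. $\mathcal{B}$ is a representative subset of $\mathcal{A}$ (collections of partitions of $X$) if $\mathcal{B}\subseteq\mathcal{A}$ and for every $P\in\mathcal{A}$ and every partition $R$ of $X$ with $P\sqcup R=\{X\}$ there is $Q\in\mathcal{B}$ with $Q\sqcup R=\{X\}$. -}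

module Defs where

open import Data.Nat using (ℕ; _%_)
open import Data.Fin using (Fin; _≟_)
open import Data.Fin.Subset as S using (Subset; _∈_; _∉_; _⊆_; _∪_; _∩_; _-_; ⁅_⁆; ∣_∣; Empty)
open import Data.Bool using (Bool; true; _∨_)
open import Data.Vec using (tabulate)
open import Data.Product using (_×_; _,_; proj₁; proj₂; Σ; ∃; ∃-syntax)
open import Data.Sum using (_⊎_)
open import Data.Unit using (⊤)
open import Relation.Nullary using (¬_; does)
open import Relation.Binary.PropositionalEquality using (_≡_; _≢_)
open import Relation.Binary.Construct.Closure.ReflexiveTransitive using (Star)
open import Function.Bundles using (_⇔_)

record Graph : Set where
  field
    n : ℕ
    m : ℕ
    end₁ : Fin m → Fin n
    end₂ : Fin m → Fin n
    loopless : ∀ e → end₁ e ≢ end₂ e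
    simple : ∀ e f →
      ((end₁ e ≡ end₁ f × end₂ e ≡ end₂ f) ⊎ (end₁ e ≡ end₂ f × end₂ e ≡ end₁ f)) →
      e ≡ f

module _ (G : Graph) where
  open Graph G

  SG : Set
  SG = Subset n × Subset m

  V : SG → Subset n
  V = proj₁

  E : SG → Subset m
  E = proj₂

  IsSubgraph : SG → Set
  IsSubgraph H = ∀ e → e ∈ E H → end₁ e ∈ V H × end₂ e ∈ V H

  _∪G_ : SG → SG → SG
  (A , B) ∪G (C , D) = (A ∪ C) , (B ∪ D)

  incident : Fin n → Subset m
  incident v = tabulate (λ e → does (v ≟ end₁ e) ∨ does (v ≟ end₂ e))

  deg : SG → Fin n → ℕ
  deg H v = ∣ E H ∩ incident v ∣

  OddDeg : SG → Fin n → Set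
  OddDeg H v = deg H v % 2 ≡ 1

  EvenDeg : SG → Fin n → Set
  EvenDeg H v = deg H v % 2 ≡ 0

  Adj : SG → Fin n → Fin n → Set
  Adj H u w = ∃[ e ] (e ∈ E H ×
    ((end₁ e ≡ u × end₂ e ≡ w) ⊎ (end₁ e ≡ w × end₂ e ≡ u)))

  Reach : SG → Fin n → Fin n → Set
  Reach H = Star (Adj H)

  Connected : SG → Set
  Connected H = ∀ u w → u ∈ V H → w ∈ V H → Reach H u w

  Eulerian : SG → Set
  Eulerian H = IsSubgraph H × Connected H × (∀ v → v ∈ V H → EvenDeg H v)

  EulerianSteiner : Subset n → SG → Set
  EulerianSteiner K H = Eulerian H × K ⊆ V H

data Tree (n m : ℕ) : Set where
  leaf   : Tree n m
  introV : Fin n → Tree n m → Tree n m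
  introE : Fin m → Tree n m → Tree n m
  forget : Fin n → Tree n m → Tree n m
  join   : Tree n m → Tree n m → Tree n m

module _ {n m : ℕ} where

  bag : Tree n m → Subset n
  bag leaf = S.⊥
  bag (introV v t) = bag t ∪ ⁅ v ⁆
  bag (introE e t) = bag t
  bag (forget v t) = bag t - v
  bag (join s t) = bag s

  Vsub : Tree n m → Subset n
  Vsub leaf = S.⊥
  Vsub (introV v t) = Vsub t ∪ ⁅ v ⁆
  Vsub (introE e t) = Vsub t
  Vsub (forget v t) = Vsub t
  Vsub (join s t) = Vsub s ∪ Vsub t

  Esub : Tree n m → Subset m
  Esub leaf = S.⊥
  Esub (introV v t) = Esub t
  Esub (introE e t) = Esub t ∪ ⁅ e ⁆
  Esub (forget v t) = Esub t
  Esub (join s t) = Esub s ∪ Esub t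

  data NodeOf : Tree n m → Tree n m → Set where
    here    : ∀ {t} → NodeOf t t
    inV     : ∀ {t T v} → NodeOf t T → NodeOf t (introV v T)
    inE     : ∀ {t T e} → NodeOf t T → NodeOf t (introE e T)
    inF     : ∀ {t T v} → NodeOf t T → NodeOf t (forget v T)
    inJoinˡ : ∀ {t T U} → NodeOf t T → NodeOf t (join T U)
    inJoinʳ : ∀ {t T U} → NodeOf t U → NodeOf t (join T U)

-- local well-formedness conditions; together with the root conditions in
-- IsNiceTD they make (T, bag) a nice tree decomposition of G in which each
-- edge is introduced exactly once.
WF : (G : Graph) → Tree (Graph.n G) (Graph.m G) → Set
WF G leaf = ⊤
WF G (introV v t) = v ∉ Vsub t × WF G t
WF G (introE e t) =
  Graph.end₁ G e ∈ bag t × Graph.end₂ G e ∈ bag t × e ∉ Esub t × WF G t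
WF G (forget v t) = v ∈ bag t × WF G t
WF G (join s t) =
  bag s ≡ bag t × (Vsub s ∩ Vsub t) ⊆ bag s × Empty (Esub s ∩ Esub t) ×
  WF G s × WF G t

IsNiceTD : (G : Graph) → Tree (Graph.n G) (Graph.m G) → Set
IsNiceTD G T = WF G T × bag T ≡ S.⊥ × Vsub T ≡ S.⊤ × Esub T ≡ S.⊤

-- The nearly-nice decomposition: v⋆ added to every bag.

module _ (G : Graph) (v⋆ : Fin (Graph.n G)) where
  open Graph G

  Xt : Tree n m → Subset n
  Xt t = bag t ∪ ⁅ v⋆ ⁆

  Vt : Tree n m → Subset n
  Vt t = Vsub t ∪ ⁅ v⋆ ⁆

  Et : Tree n m → Subset m
  Et t = Esub t

  Residual : Tree n m → SG G → Set
  Residual t H =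
    (∀ v → v ∈ V G H → v ∈ Vt t → v ∈ Xt t) × Empty (E G H ∩ Et t)

-- Partitions of a vertex set X, given as (decidable) equivalence relations
-- on X: two elements are related iff they lie in the same block.

PRel : ℕ → Set
PRel n = Fin n → Fin n → Bool

module _ {n : ℕ} where

  _∋_~_ : PRel n → Fin n → Fin n → Set
  P ∋ x ~ y = P x y ≡ true

  IsPartitionOf : Subset n → PRel n → Set
  IsPartitionOf X P =
    (∀ x y → P ∋ x ~ y → x ∈ X × y ∈ X) ×
    (∀ x → x ∈ X → P ∋ x ~ x) ×
    (∀ x y → P ∋ x ~ y → P ∋ y ~ x) ×
    (∀ x y z → P ∋ x ~ y → P ∋ y ~ z → P ∋ x ~ z)

  -- P ⊔ R = {X}: the finest partition coarser than both is the one-block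
  -- partition, i.e. the equivalence closure of P ∪ R relates all of X.
  JoinIsTop : Subset n → PRel n → PRel n → Set
  JoinIsTop X P R =
    ∀ x y → x ∈ X → y ∈ X → Star (λ a b → P ∋ a ~ b ⊎ R ∋ a ~ b) x y

  Representative : Subset n → (PRel n → Set) → (PRel n → Set) → Set
  Representative X A B =
    (∀ P → B P → A P) ×
    (∀ P → A P → ∀ R → IsPartitionOf X R → JoinIsTop X P R →
       ∃[ Q ] (B Q × JoinIsTop X Q R))

module _ (G : Graph) (K : Subset (Graph.n G)) (v⋆ : Fin (Graph.n G)) where
  open Graph G

  -- G' is a witness that P is valid for (t, X, O).
  -- "G' has exactly p components C_i with X^i ⊆ V(C_i)" is written out as:
  -- two vertices of X are in the same block of P iff they are connected in
  -- G', and every vertex of G' is connected in G' to some vertex of X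
  -- (so each component of G' contains exactly one block).
  Witness : Tree n m → Subset n → Subset n → PRel n → SG G → Set
  Witness t X O P G' =
    IsSubgraph G G' ×
    V G G' ⊆ Vt G v⋆ t × E G G' ⊆ Et G v⋆ t ×
    (Xt G v⋆ t ∩ V G G') ≡ X ×
    (∀ x y → x ∈ X → y ∈ X → ((P ∋ x ~ y) ⇔ Reach G G' x y)) ×
    (∀ v → v ∈ V G G' → ∃[ x ] (x ∈ X × Reach G G' v x)) ×
    (K ∩ Vt G v⋆ t) ⊆ V G G' ×
    (∀ v → v ∈ O ⇔ (v ∈ V G G' × OddDeg G G' v))

  Valid : Tree n m → Subset n → Subset n → PRel n → Set
  Valid t X O P = ∃[ G' ] Witness t X O P G'

  Completes : Tree n m → Subset n → Subset n → PRel n → SG G → Set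
  Completes t X O P H =
    ∃[ G' ] (Witness t X O P G' × EulerianSteiner G K (_∪G_ G G' H))

module Submission where

-- Let GP ∪ H be an Eulerian Steiner subgraph, GP a witness for (t, X, O, P).
-- Let R be the partition of X into the components of the residual graph H.
-- We show:
--   (1) P ⊔ R = {X}: walking along a path of GP ∪ H, each change between GP
--       and H happens at a vertex shared by both, and such vertices lie in X;
--   (2) every vertex of H is joined inside H to a vertex of X, and every
--       terminal outside V_t lies in H;
--   (3) conversely, if Q ⊔ R = {X} and GQ is any witness for (t, X, O, Q),
--       then GQ ∪ H is an Eulerian Steiner subgraph: (2) and Q ⊔ R = {X} make
--       it connected, and degree parities agree with those of GP ∪ H because
--       both witnesses have odd set O and are edge-disjoint from H.
-- Since R is itself a partition of X, representativity of B yields Q ∈ B with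
-- Q ⊔ R = {X}, and (3) finishes the proof.

open import Defs
open import Data.Bool using (true; if_then_else_; _∨_)
open import Data.Empty using (⊥-elim)
open import Data.Fin using (Fin; _≟_)
open import Data.Fin.Subset using (Subset; _∈_; _∉_; _⊆_; _∩_; _∪_; ∣_∣; Empty; inside; outside)
open import Data.Fin.Subset.Properties
  using (_∈?_; x∈p∪q⁺; x∈p∪q⁻; x∈p∩q⁺; x∈p∩q⁻; x∈⁅x⁆; drop-∷-Empty; Empty-unique; ∣⊥∣≡0; ∩-distribʳ-∪)
open import Data.List using (List; []; _∷_; map; filter; allFin)
open import Data.List.Membership.Propositional using () renaming (_∈_ to _∈ₗ_)
open import Data.List.Membership.Propositional.Properties using (∈-map∘filter⁺; ∈-map∘filter⁻; ∈-allFin)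
open import Data.List.Relation.Unary.Any using (here; there)
open import Data.Nat using (suc; _+_; _%_; s≤s)
open import Data.Nat.DivMod using (%-distribˡ-+; m%n<n)
open import Data.Nat.Properties using (+-suc)
open import Data.Product using (_×_; ∃-syntax; _,_; proj₁; proj₂)
open import Data.Sum using (_⊎_; inj₁; inj₂)
open import Data.Vec using ([]; _∷_) renaming (here to at-head)
open import Data.Vec.Properties using (lookup∘tabulate; []=⇒lookup)
open import Function using (id; _∘_)
open import Function.Bundles using (_⇔_; Equivalence)
open import Relation.Binary.Core using (Rel; _⇒_)
open import Relation.Binary.Definitions using (Decidable; DecidableEquality)
open import Relation.Binary.PropositionalEquality
  using (_≡_; refl; sym; trans; cong; subst; isEquivalence; module ≡-Reasoning)
open import Relation.Binary.Construct.Closure.Equivalence as EqClosure using (EqClosure)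
open import Relation.Binary.Construct.Closure.ReflexiveTransitive as Star using (ε; _◅_; _◅◅_)
open import Relation.Binary.Construct.Closure.Symmetric as SymClosure using (fwd; bwd)
open import Relation.Nullary using (Dec; yes; no; does)
open import Relation.Nullary.Decidable using (dec-true; map′; _×-dec_; _⊎-dec_)

true⇒proof : ∀ {A : Set} (d : Dec A) → does d ≡ true → A
true⇒proof (yes a) _  = a
true⇒proof (no  _) ()

-- The equivalence closure of a finite list of pairs is decidable when
-- equality is: merging the classes of the pairs one at a time yields a
-- labelling whose fibres are exactly the equivalence classes.
module Labelling {A : Set} (_≟_ : DecidableEquality A) where

  squash : A → A → A → A
  squash u w z = if does (z ≟ w) then u else z

  -- label ps sends each element to a representative of its class.
  label : List (A × A) → A → A
  label []             = id
  label ((a , b) ∷ ps) = squash (label ps a) (label ps b) ∘ label ps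

  Listed : List (A × A) → Rel A _
  Listed ps a b = (a , b) ∈ₗ ps

  squash-target : ∀ u w → squash u w w ≡ u
  squash-target u w rewrite dec-true (w ≟ w) refl = refl

  squash-source : ∀ u w → squash u w u ≡ u
  squash-source u w with u ≟ w
  ... | yes _ = refl
  ... | no  _ = refl

  squash-merges : ∀ u w z z' → squash u w z ≡ squash u w z' →
    z ≡ z' ⊎ ((z ≡ u ⊎ z ≡ w) × (z' ≡ u ⊎ z' ≡ w))
  squash-merges u w z z' eq with z ≟ w | z' ≟ w
  ... | yes zw | yes z'w = inj₂ (inj₂ zw , inj₂ z'w)
  ... | yes zw | no  _   = inj₂ (inj₂ zw , inj₁ (sym eq))
  ... | no  _  | yes z'w = inj₂ (inj₁ eq , inj₂ z'w)
  ... | no  _  | no  _   = inj₁ eq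

  label-identifies : ∀ ps {a b} → Listed ps a b → label ps a ≡ label ps b
  label-identifies ((a , b) ∷ ps) (here refl) =
    trans (squash-source (label ps a) (label ps b)) (sym (squash-target (label ps a) (label ps b)))
  label-identifies (_ ∷ ps) (there p) = cong (squash _ _) (label-identifies ps p)

  label-complete : ∀ ps {x y} → EqClosure (Listed ps) x y → label ps x ≡ label ps y
  label-complete ps = EqClosure.gfold isEquivalence (label ps) (label-identifies ps)

  weaken : ∀ {p ps} → EqClosure (Listed ps) ⇒ EqClosure (Listed (p ∷ ps))
  weaken = EqClosure.map there

  label-sound : ∀ ps {x y} → label ps x ≡ label ps y → EqClosure (Listed ps) x y
  label-sound []             refl = ε
  label-sound ((a , b) ∷ ps) {x} {y} eq
    with squash-merges (label ps a) (label ps b) (label ps x) (label ps y) eq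
  ... | inj₁ xy         = weaken (label-sound ps xy)
  ... | inj₂ (x≈ , y≈) = linked-to-a x≈ ◅◅ EqClosure.symmetric _ (linked-to-a y≈)
    where
    linked-to-a : ∀ {z} → label ps z ≡ label ps a ⊎ label ps z ≡ label ps b →
      EqClosure (Listed ((a , b) ∷ ps)) z a
    linked-to-a (inj₁ za) = weaken (label-sound ps za)
    linked-to-a (inj₂ zb) =
      weaken (label-sound ps zb) ◅◅ EqClosure.symmetric _ (EqClosure.return (here refl))

  closure? : ∀ ps → Decidable (EqClosure (Listed ps))
  closure? ps x y = map′ (label-sound ps) (label-complete ps) (label ps x ≟ label ps y)

∣∪∣-disjoint : ∀ {k} (p q : Subset k) → Empty (p ∩ q) → ∣ p ∪ q ∣ ≡ ∣ p ∣ + ∣ q ∣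
∣∪∣-disjoint []            []            _ = refl
∣∪∣-disjoint (inside  ∷ p) (inside  ∷ q) d = ⊥-elim (d (_ , at-head))
∣∪∣-disjoint (inside  ∷ p) (outside ∷ q) d = cong suc (∣∪∣-disjoint p q (drop-∷-Empty d))
∣∪∣-disjoint (outside ∷ p) (inside  ∷ q) d =
  trans (cong suc (∣∪∣-disjoint p q (drop-∷-Empty d))) (sym (+-suc ∣ p ∣ ∣ q ∣))
∣∪∣-disjoint (outside ∷ p) (outside ∷ q) d = ∣∪∣-disjoint p q (drop-∷-Empty d)

%2-cases : ∀ k → k % 2 ≡ 0 ⊎ k % 2 ≡ 1
%2-cases k with k % 2 | m%n<n k 2
... | 0           | _             = inj₁ refl
... | 1           | _             = inj₂ refl
... | suc (suc _) | s≤s (s≤s ())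

module GraphFacts (G : Graph) where
  open Graph G

  _⊕_ : SG G → SG G → SG G
  _⊕_ = _∪G_ G

  adj-sym : ∀ H {u w} → Adj G H u w → Adj G H w u
  adj-sym H (e , e∈H , inj₁ ends) = e , e∈H , inj₂ ends
  adj-sym H (e , e∈H , inj₂ ends) = e , e∈H , inj₁ ends

  reach-sym : ∀ H {u w} → Reach G H u w → Reach G H w u
  reach-sym H = Star.reverse (adj-sym H)

  adj-ends : ∀ {H u w} → IsSubgraph G H → Adj G H u w → u ∈ V G H × w ∈ V G H
  adj-ends sub (e , e∈H , inj₁ (refl , refl)) = sub e e∈H
  adj-ends sub (e , e∈H , inj₂ (refl , refl)) = proj₂ (sub e e∈H) , proj₁ (sub e e∈H)

  reach-start : ∀ {H u w} → IsSubgraph G H → Reach G H u w → w ∈ V G H → u ∈ V G H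
  reach-start sub ε        w∈H = w∈H
  reach-start sub (a ◅ _) _   = proj₁ (adj-ends sub a)

  adj-split : ∀ A B {u w} → Adj G (A ⊕ B) u w → Adj G A u w ⊎ Adj G B u w
  adj-split A B (e , e∈ , ends) with x∈p∪q⁻ (E G A) (E G B) e∈
  ... | inj₁ e∈A = inj₁ (e , e∈A , ends)
  ... | inj₂ e∈B = inj₂ (e , e∈B , ends)

  reach-⊕ˡ : ∀ A B {u w} → Reach G A u w → Reach G (A ⊕ B) u w
  reach-⊕ˡ A B = Star.map λ { (e , e∈A , ends) → e , x∈p∪q⁺ (inj₁ e∈A) , ends }

  reach-⊕ʳ : ∀ A B {u w} → Reach G B u w → Reach G (A ⊕ B) u w
  reach-⊕ʳ A B = Star.map λ { (e , e∈B , ends) → e , x∈p∪q⁺ {p = E G A} (inj₂ e∈B) , ends }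

  subgraph-⊕ : ∀ {A B} → IsSubgraph G A → IsSubgraph G B → IsSubgraph G (A ⊕ B)
  subgraph-⊕ {A} {B} subA subB e e∈ with x∈p∪q⁻ (E G A) (E G B) e∈
  ... | inj₁ e∈A = x∈p∪q⁺ (inj₁ (proj₁ (subA e e∈A))) , x∈p∪q⁺ (inj₁ (proj₂ (subA e e∈A)))
  ... | inj₂ e∈B = x∈p∪q⁺ {p = V G A} (inj₂ (proj₁ (subB e e∈B)))
                 , x∈p∪q⁺ {p = V G A} (inj₂ (proj₂ (subB e e∈B)))

  edgeList : SG G → List (Fin n × Fin n)
  edgeList H = map (λ e → end₁ e , end₂ e) (filter (_∈? E G H) (allFin m))

  open Labelling (_≟_ {n}) using (Listed; closure?)

  listed⇒adj : ∀ H {u w} → Listed (edgeList H) u w → Adj G H u w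
  listed⇒adj H p with ∈-map∘filter⁻ (λ e → end₁ e , end₂ e) (_∈? E G H) {xs = allFin m} p
  ... | e , _ , refl , e∈H = e , e∈H , inj₁ (refl , refl)

  edge-listed : ∀ H e → e ∈ E G H → Listed (edgeList H) (end₁ e) (end₂ e)
  edge-listed H e e∈H =
    ∈-map∘filter⁺ (λ e → end₁ e , end₂ e) (_∈? E G H) (e , ∈-allFin e , refl , e∈H)

  adj⇒listed : ∀ H {u w} → Adj G H u w → SymClosure.SymClosure (Listed (edgeList H)) u w
  adj⇒listed H (e , e∈H , inj₁ (refl , refl)) = fwd (edge-listed H e e∈H)
  adj⇒listed H (e , e∈H , inj₂ (refl , refl)) = bwd (edge-listed H e e∈H)

  reach? : ∀ H → Decidable (Reach G H)
  reach? H x y = map′ (Star.map (SymClosure.fold (adj-sym H) (listed⇒adj H)))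
                      (Star.map (adj⇒listed H))
                      (closure? (edgeList H) x y)

  incident-ends : ∀ {v e} → e ∈ incident G v → v ≡ end₁ e ⊎ v ≡ end₂ e
  incident-ends {v} {e} e∈ =
    true⇒proof ((v ≟ end₁ e) ⊎-dec (v ≟ end₂ e))
      (trans (sym (lookup∘tabulate (λ e → does (v ≟ end₁ e) ∨ does (v ≟ end₂ e)) e))
             ([]=⇒lookup e∈))

  deg-outside : ∀ {H v} → IsSubgraph G H → v ∉ V G H → deg G H v ≡ 0
  deg-outside {H} {v} sub v∉H = trans (cong ∣_∣ (Empty-unique no-edge)) (∣⊥∣≡0 m)
    where
    no-edge : Empty (E G H ∩ incident G v)
    no-edge (e , e∈) with x∈p∩q⁻ (E G H) (incident G v) e∈
    ... | e∈H , e∈inc with incident-ends {v} e∈inc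
    ... | inj₁ refl = v∉H (proj₁ (sub e e∈H))
    ... | inj₂ refl = v∉H (proj₂ (sub e e∈H))

  deg-⊕ : ∀ A B v → Empty (E G A ∩ E G B) → deg G (A ⊕ B) v ≡ deg G A v + deg G B v
  deg-⊕ A B v disjoint = begin
      ∣ (E G A ∪ E G B) ∩ incident G v ∣
    ≡⟨ cong ∣_∣ (∩-distribʳ-∪ (incident G v) (E G A) (E G B)) ⟩
      ∣ (E G A ∩ incident G v) ∪ (E G B ∩ incident G v) ∣
    ≡⟨ ∣∪∣-disjoint _ _ disjoint-at-v ⟩
      deg G A v + deg G B v ∎
    where
    open ≡-Reasoning
    disjoint-at-v : Empty ((E G A ∩ incident G v) ∩ (E G B ∩ incident G v))
    disjoint-at-v (e , e∈) with x∈p∩q⁻ _ _ e∈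
    ... | e∈A , e∈B = disjoint (e , x∈p∩q⁺ (proj₁ (x∈p∩q⁻ _ _ e∈A) , proj₁ (x∈p∩q⁻ _ _ e∈B)))

  parity-⊕ : ∀ A A' H v → Empty (E G A ∩ E G H) → Empty (E G A' ∩ E G H) →
    deg G A v % 2 ≡ deg G A' v % 2 → deg G (A ⊕ H) v % 2 ≡ deg G (A' ⊕ H) v % 2
  parity-⊕ A A' H v dA dA' same = begin
      deg G (A ⊕ H) v % 2
    ≡⟨ cong (_% 2) (deg-⊕ A H v dA) ⟩
      (deg G A v + deg G H v) % 2
    ≡⟨ %-distribˡ-+ (deg G A v) (deg G H v) 2 ⟩
      (deg G A v % 2 + deg G H v % 2) % 2
    ≡⟨ cong (λ k → (k + deg G H v % 2) % 2) same ⟩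
      (deg G A' v % 2 + deg G H v % 2) % 2
    ≡⟨ %-distribˡ-+ (deg G A' v) (deg G H v) 2 ⟨
      (deg G A' v + deg G H v) % 2
    ≡⟨ cong (_% 2) (deg-⊕ A' H v dA') ⟨
      deg G (A' ⊕ H) v % 2 ∎
    where open ≡-Reasoning

module Completion (G : Graph) (K : Subset (Graph.n G)) (v⋆ : Fin (Graph.n G))
  (t : Tree (Graph.n G) (Graph.m G)) (X O : Subset (Graph.n G))
  (H : SG G) (H-sub : IsSubgraph G H) (H-res : Residual G v⋆ t H)
  (H-trace : (Xt G v⋆ t ∩ V G H) ≡ X) where

  open Graph G
  open GraphFacts G

  H∩Vt⊆X : ∀ {v} → v ∈ V G H → v ∈ Vt G v⋆ t → v ∈ X
  H∩Vt⊆X v∈H v∈Vt = subst (_ ∈_) H-trace (x∈p∩q⁺ (proj₁ H-res _ v∈H v∈Vt , v∈H))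

  X⊆H : X ⊆ V G H
  X⊆H x∈X = proj₂ (x∈p∩q⁻ (Xt G v⋆ t) (V G H) (subst (_ ∈_) (sym H-trace) x∈X))

  module Parts {P : PRel n} {G' : SG G} (w : Witness G K v⋆ t X O P G') where

    subgraph : IsSubgraph G G'
    subgraph = proj₁ w

    within-Vt : V G G' ⊆ Vt G v⋆ t
    within-Vt = proj₁ (proj₂ w)

    within-Et : E G G' ⊆ Et G v⋆ t
    within-Et = proj₁ (proj₂ (proj₂ w))

    trace : (Xt G v⋆ t ∩ V G G') ≡ X
    trace = proj₁ (proj₂ (proj₂ (proj₂ w)))

    blocks : ∀ x y → x ∈ X → y ∈ X → (P ∋ x ~ y) ⇔ Reach G G' x y
    blocks = proj₁ (proj₂ (proj₂ (proj₂ (proj₂ w))))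

    reaches-X : ∀ v → v ∈ V G G' → ∃[ x ] (x ∈ X × Reach G G' v x)
    reaches-X = proj₁ (proj₂ (proj₂ (proj₂ (proj₂ (proj₂ w)))))

    terminals : (K ∩ Vt G v⋆ t) ⊆ V G G'
    terminals = proj₁ (proj₂ (proj₂ (proj₂ (proj₂ (proj₂ (proj₂ w))))))

    odd-set : ∀ v → v ∈ O ⇔ (v ∈ V G G' × OddDeg G G' v)
    odd-set = proj₂ (proj₂ (proj₂ (proj₂ (proj₂ (proj₂ (proj₂ w))))))

    X⊆G' : X ⊆ V G G'
    X⊆G' x∈X = proj₂ (x∈p∩q⁻ (Xt G v⋆ t) (V G G') (subst (_ ∈_) (sym trace) x∈X))

    disjoint-from-H : Empty (E G G' ∩ E G H)
    disjoint-from-H (e , e∈) with x∈p∩q⁻ (E G G') (E G H) e∈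
    ... | e∈G' , e∈H = proj₂ H-res (e , x∈p∩q⁺ (e∈H , within-Et e∈G'))

    shared⊆X : ∀ {v} → v ∈ V G G' → v ∈ V G H → v ∈ X
    shared⊆X v∈G' v∈H = H∩Vt⊆X v∈H (within-Vt v∈G')

    -- v⋆ is a terminal in every bag, so it lies in X.
    v⋆∈X : v⋆ ∈ K → v⋆ ∈ X
    v⋆∈X v⋆∈K = subst (_ ∈_) trace (x∈p∩q⁺ (v⋆∈Xt , terminals (x∈p∩q⁺ (v⋆∈K , v⋆∈Vt))))
      where
      v⋆∈Xt : v⋆ ∈ Xt G v⋆ t
      v⋆∈Xt = x∈p∪q⁺ {p = bag t} (inj₂ (x∈⁅x⁆ v⋆))
      v⋆∈Vt : v⋆ ∈ Vt G v⋆ t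
      v⋆∈Vt = x∈p∪q⁺ {p = Vsub t} (inj₂ (x∈⁅x⁆ v⋆))

    parity-in-O : ∀ v → v ∈ O → deg G G' v % 2 ≡ 1
    parity-in-O v v∈O = proj₂ (Equivalence.to (odd-set v) v∈O)

    parity-outside-O : ∀ v → v ∉ O → deg G G' v % 2 ≡ 0
    parity-outside-O v v∉O with v ∈? V G G'
    ... | no v∉G' = cong (_% 2) (deg-outside subgraph v∉G')
    ... | yes v∈G' with %2-cases (deg G G' v)
    ...   | inj₁ even = even
    ...   | inj₂ odd  = ⊥-elim (v∉O (Equivalence.from (odd-set v) (v∈G' , odd)))

  same-parity : ∀ {P Q GP GQ} → Witness G K v⋆ t X O P GP → Witness G K v⋆ t X O Q GQ →
    ∀ v → deg G GQ v % 2 ≡ deg G GP v % 2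
  same-parity wP wQ v with v ∈? O
  ... | yes v∈O = trans (Parts.parity-in-O wQ v v∈O) (sym (Parts.parity-in-O wP v v∈O))
  ... | no  v∉O = trans (Parts.parity-outside-O wQ v v∉O) (sym (Parts.parity-outside-O wP v v∉O))

  R : PRel n
  R x y = does ((x ∈? X) ×-dec (y ∈? X) ×-dec reach? H x y)

  R-intro : ∀ {x y} → x ∈ X → y ∈ X → Reach G H x y → R ∋ x ~ y
  R-intro {x} {y} x∈X y∈X r = dec-true ((x ∈? X) ×-dec (y ∈? X) ×-dec reach? H x y) (x∈X , y∈X , r)

  R-elim : ∀ x y → R ∋ x ~ y → x ∈ X × y ∈ X × Reach G H x y
  R-elim x y = true⇒proof ((x ∈? X) ×-dec (y ∈? X) ×-dec reach? H x y)

  R-partition : IsPartitionOf X R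
  R-partition = (λ x y xRy → let (x∈X , y∈X , _) = R-elim x y xRy in x∈X , y∈X)
              , (λ x x∈X → R-intro x∈X x∈X ε)
              , (λ x y xRy → let (x∈X , y∈X , r) = R-elim x y xRy in R-intro y∈X x∈X (reach-sym H r))
              , (λ x y z xRy yRz → let (x∈X , _ , r) = R-elim x y xRy ; (_ , z∈X , r') = R-elim y z yRz
                                   in R-intro x∈X z∈X (r ◅◅ r'))

  Linked : PRel n → Fin n → Fin n → Set
  Linked P = Star.Star (λ a b → P ∋ a ~ b ⊎ R ∋ a ~ b)

  module FromCompletion (v⋆∈K : v⋆ ∈ K) {P : PRel n} {GP : SG G}
    (wP : Witness G K v⋆ t X O P GP) (eulerian : EulerianSteiner G K (GP ⊕ H)) where

    module WP = Parts wP

    connected : Connected G (GP ⊕ H)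
    connected = proj₁ (proj₂ (proj₁ eulerian))

    Anchored : Fin n → Fin n → Set
    Anchored x v = ∃[ x' ] (x' ∈ X × Linked P x x' × (Reach G GP v x' ⊎ Reach G H v x'))

    -- Leaving GP for H, or H for GP, happens at a shared vertex, which lies in X.
    anchored-step : ∀ {x v w} → Anchored x v → Adj G (GP ⊕ H) v w → Anchored x w
    anchored-step (x' , x'∈X , link , inj₁ rP) adj with adj-split GP H adj
    ... | inj₁ aP = x' , x'∈X , link , inj₁ (adj-sym GP aP ◅ rP)
    anchored-step {v = v} (x' , x'∈X , link , inj₁ rP) adj | inj₂ aH =
      v , v∈X , link ◅◅ (inj₁ x'Pv ◅ ε) , inj₂ (adj-sym H aH ◅ ε)
      where
      v∈X = WP.shared⊆X (reach-start WP.subgraph rP (WP.X⊆G' x'∈X)) (proj₁ (adj-ends H-sub aH))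
      x'Pv = Equivalence.from (WP.blocks x' v x'∈X v∈X) (reach-sym GP rP)
    anchored-step (x' , x'∈X , link , inj₂ rH) adj with adj-split GP H adj
    ... | inj₂ aH = x' , x'∈X , link , inj₂ (adj-sym H aH ◅ rH)
    anchored-step {v = v} (x' , x'∈X , link , inj₂ rH) adj | inj₁ aP =
      v , v∈X , link ◅◅ (inj₂ (R-intro x'∈X v∈X (reach-sym H rH)) ◅ ε) , inj₁ (adj-sym GP aP ◅ ε)
      where
      v∈X = WP.shared⊆X (proj₁ (adj-ends WP.subgraph aP)) (reach-start H-sub rH (X⊆H x'∈X))

    anchored-path : ∀ {x v w} → Anchored x v → Reach G (GP ⊕ H) v w → Anchored x w
    anchored-path a ε       = a
    anchored-path a (s ◅ p) = anchored-path (anchored-step a s) p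

    join-top : JoinIsTop X P R
    join-top x y x∈X y∈X
      with anchored-path (x , x∈X , ε , inj₁ ε)
             (connected x y (x∈p∪q⁺ (inj₁ (WP.X⊆G' x∈X))) (x∈p∪q⁺ (inj₁ (WP.X⊆G' y∈X))))
    ... | x' , x'∈X , link , inj₁ rP =
      link ◅◅ (inj₁ (Equivalence.from (WP.blocks x' y x'∈X y∈X) (reach-sym GP rP)) ◅ ε)
    ... | x' , x'∈X , link , inj₂ rH = link ◅◅ (inj₂ (R-intro x'∈X y∈X (reach-sym H rH)) ◅ ε)

    -- (2) A path of GP ⊕ H from a vertex of H to X stays in H until it
    -- enters V_t, and it does so at a vertex of X.
    H-path-to-X : ∀ {u z} → u ∈ V G H → Reach G (GP ⊕ H) u z → z ∈ X →
      ∃[ x ] (x ∈ X × Reach G H u x)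
    H-path-to-X {u} u∈H ε z∈X = u , z∈X , ε
    H-path-to-X {u} u∈H (s ◅ p) z∈X with u ∈? Vt G v⋆ t
    ... | yes u∈Vt = u , H∩Vt⊆X u∈H u∈Vt , ε
    ... | no  u∉Vt with adj-split GP H s
    ...   | inj₁ aP = ⊥-elim (u∉Vt (WP.within-Vt (proj₁ (adj-ends WP.subgraph aP))))
    ...   | inj₂ aH with H-path-to-X (proj₂ (adj-ends H-sub aH)) p z∈X
    ...     | x , x∈X , r = x , x∈X , aH ◅ r

    H-reaches-X : ∀ {u} → u ∈ V G H → ∃[ x ] (x ∈ X × Reach G H u x)
    H-reaches-X {u} u∈H = H-path-to-X u∈H (connected u v⋆ u∈GP⊕H v⋆∈GP⊕H) v⋆∈X
      where
      v⋆∈X = WP.v⋆∈X v⋆∈K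
      u∈GP⊕H = x∈p∪q⁺ {p = V G GP} (inj₂ u∈H)
      v⋆∈GP⊕H = x∈p∪q⁺ (inj₁ (WP.X⊆G' v⋆∈X))

    even-everywhere : ∀ v → deg G (GP ⊕ H) v % 2 ≡ 0
    even-everywhere v with v ∈? V G (GP ⊕ H)
    ... | yes v∈ = proj₂ (proj₂ (proj₁ eulerian)) v v∈
    ... | no  v∉ = cong (_% 2) (deg-outside (subgraph-⊕ WP.subgraph H-sub) v∉)

    module _ {Q : PRel n} (Q-partition : IsPartitionOf X Q) {GQ : SG G}
      (wQ : Witness G K v⋆ t X O Q GQ) (Q⊔R : JoinIsTop X Q R) where

      module WQ = Parts wQ

      reaches-X : ∀ {u} → u ∈ V G (GQ ⊕ H) → ∃[ x ] (x ∈ X × Reach G (GQ ⊕ H) u x)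
      reaches-X {u} u∈ with x∈p∪q⁻ (V G GQ) (V G H) u∈
      ... | inj₁ u∈GQ = let (x , x∈X , r) = WQ.reaches-X u u∈GQ in x , x∈X , reach-⊕ˡ GQ H r
      ... | inj₂ u∈H  = let (x , x∈X , r) = H-reaches-X u∈H in x , x∈X , reach-⊕ʳ GQ H r

      linked⇒reach : ∀ {a b} → Linked Q a b → Reach G (GQ ⊕ H) a b
      linked⇒reach ε = ε
      linked⇒reach {a} (_◅_ {j = c} (inj₁ aQc) p) =
        let (a∈X , c∈X) = proj₁ Q-partition a c aQc
        in reach-⊕ˡ GQ H (Equivalence.to (WQ.blocks a c a∈X c∈X) aQc) ◅◅ linked⇒reach p
      linked⇒reach {a} (_◅_ {j = c} (inj₂ aRc) p) =
        reach-⊕ʳ GQ H (proj₂ (proj₂ (R-elim a c aRc))) ◅◅ linked⇒reach p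

      connected-Q : Connected G (GQ ⊕ H)
      connected-Q u w u∈ w∈ =
        let (x , x∈X , ru) = reaches-X u∈ ; (y , y∈X , rw) = reaches-X w∈
        in ru ◅◅ linked⇒reach (Q⊔R x y x∈X y∈X) ◅◅ reach-sym (GQ ⊕ H) rw

      even-Q : ∀ v → v ∈ V G (GQ ⊕ H) → EvenDeg G (GQ ⊕ H) v
      even-Q v _ = trans (parity-⊕ GQ GP H v WQ.disjoint-from-H WP.disjoint-from-H (same-parity wP wQ v))
                         (even-everywhere v)

      -- Terminals inside V_t lie in GQ; the others are vertices of H.
      terminals-Q : K ⊆ V G (GQ ⊕ H)
      terminals-Q {k} k∈K with k ∈? Vt G v⋆ t
      ... | yes k∈Vt = x∈p∪q⁺ (inj₁ (WQ.terminals (x∈p∩q⁺ (k∈K , k∈Vt))))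
      ... | no  k∉Vt with x∈p∪q⁻ (V G GP) (V G H) (proj₂ eulerian k∈K)
      ...   | inj₁ k∈GP = ⊥-elim (k∉Vt (WP.within-Vt k∈GP))
      ...   | inj₂ k∈H  = x∈p∪q⁺ {p = V G GQ} (inj₂ k∈H)

      completes : EulerianSteiner G K (GQ ⊕ H)
      completes = (subgraph-⊕ WQ.subgraph H-sub , connected-Q , even-Q) , terminals-Q

lemma16 : (G : Graph) (K : Subset (Graph.n G)) (v⋆ : Fin (Graph.n G)) →
    v⋆ ∈ K →
    (T : Tree (Graph.n G) (Graph.m G)) → IsNiceTD G T →
    (t : Tree (Graph.n G) (Graph.m G)) → NodeOf t T →
    (X O : Subset (Graph.n G)) → X ⊆ Xt G v⋆ t → O ⊆ X →
    (A B : PRel (Graph.n G) → Set) →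
    (∀ P → A P → IsPartitionOf X P × Valid G K v⋆ t X O P) →
    Representative X A B →
    (H : SG G) → IsSubgraph G H → Residual G v⋆ t H →
    (Xt G v⋆ t ∩ V G H) ≡ X →
    (∃[ P ] (A P × Completes G K v⋆ t X O P H)) →
    ∃[ Q ] (B Q × Completes G K v⋆ t X O Q H)
lemma16 G K v⋆ v⋆∈K _ _ t _ X O _ _ A B A-valid (B⊆A , B-represents)
        H H-sub H-res H-trace (P , P∈A , GP , wP , eulerian) =
  let open Completion G K v⋆ t X O H H-sub H-res H-trace
      open FromCompletion v⋆∈K wP eulerian
      (Q , Q∈B , Q⊔R) = B-represents P P∈A R R-partition join-top
      (Q-partition , GQ , wQ) = A-valid Q (B⊆A Q Q∈B)
  in Q , Q∈B , GQ , wQ , completes Q-partition wQ Q⊔R
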